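{- There exists a constant $c>0$ such that for all integers $n_1,n_2\ge1$, $(n_1+n_2)H_{n_1+n_2}-n_1H_{n_1}-n_2H_{n_2}\ge c\ln\binom{n_1+n_2}{n_1}$.
   Context: $H_q=\sum_{m=1}^q 1/m$ denotes the $q$-th harmonic number. -}

module Defs where

open import Data.Nat as ℕ using (ℕ; zero; suc)
open import Data.Nat.Combinatorics using (_C_)
open import Data.Integer as ℤ using (ℤ; +_)
open import Data.Rational using (ℚ; 0ℚ; 1ℚ; _/_; _+_; _*_; _-_; _<_; _≤_; Positive; ↥_; ↧ₙ_)
open import Data.Product using (Σ; _×_)

ℕ→ℚ : ℕ → ℚ
ℕ→ℚ n = + n / 1

H : ℕ → ℚ
H zero    = 0ℚ
H (suc q) = H q + (+ 1 / suc q)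

expTerm : ℚ → ℕ → ℚ
expTerm y zero    = 1ℚ
expTerm y (suc k) = expTerm y k * y * (+ 1 / suc k)

expPartial : ℚ → ℕ → ℚ
expPartial y zero    = 1ℚ
expPartial y (suc N) = expPartial y N + expTerm y (suc N)

-- M ≤ exp y  (exp y = lim_N S_N(y)), i.e. for every ε > 0 the partial
-- sums are eventually > M - ε.
_≤exp_ : ℚ → ℚ → Set
M ≤exp y = (ε : ℚ) → Positive ε →
  Σ ℕ λ N → (n : ℕ) → N ℕ.≤ n → M - ε < expPartial y n

-- For c = p/q > 0 (p = numerator, q = denominator) and B ≥ 1:
--   c · ln B ≤ x   ⟺   p · ln B ≤ q · x   ⟺   B^p ≤ exp (q · x).
_·ln_≤_ : ℚ → ℕ → ℚ → Set
c ·ln B ≤ x = ℕ→ℚ (B ℕ.^ ℤ.∣ ↥ c ∣) ≤exp (ℕ→ℚ (↧ₙ c) * x)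

gap : ℕ → ℕ → ℚ
gap n₁ n₂ = ℕ→ℚ (n₁ ℕ.+ n₂) * H (n₁ ℕ.+ n₂) - ℕ→ℚ n₁ * H n₁ - ℕ→ℚ n₂ * H n₂

{-# OPTIONS --safe #-}
module Submission where

-- We take c = 1 and show C(m+n, m) ≤ exp (gap m n) by induction on n,
-- with exp approximated from below by its partial sums.  Since
-- (n+1) C(m+n+1, m) = (m+n+1) C(m+n, m) and
-- gap m (n+1) = gap m n + (H_{m+n} - H_n), the step amounts to
--   (m+n+1)/(n+1) = ∏_{i=n+1}^{m+n} (1 + 1/i) ≤ exp (∑_{i=n+1}^{m+n} 1/i),
-- which follows from (1 + a) e^b ≤ e^{a+b} for a, b ≥ 0.

open import Defs

module _ where

  open import Data.Nat.Base as ℕ using (ℕ; zero; suc; _!; _≤′_; ≤′-refl; ≤′-step)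
  import Data.Nat.Properties as ℕ
  open import Data.Nat.Combinatorics using (_C_; nCk≡n!/k![n-k]!; k![n∸k]!∣n!; nCn≡1)
  open import Data.Nat.DivMod using (m/n*n≡m)
  import Data.Nat.Tactic.RingSolver as ℕ-Solver
  open import Data.Integer.Base as ℤ using (+_)
  import Data.Integer.Properties as ℤ
  import Data.Integer.Tactic.RingSolver as ℤ-Solver
  open import Data.Rational
  open import Data.Rational.Properties
  import Data.Rational.Unnormalised as ℚᵘ
  import Data.Rational.Unnormalised.Properties as ℚᵘ
  open import Data.Product.Base using (Σ; _,_)
  open import Level using (0ℓ)
  open import Relation.Nullary.Decidable.Core using (dec⇒maybe)
  open import Relation.Binary.PropositionalEquality
    using (_≡_; sym; trans; cong; cong₂; subst; subst₂; module ≡-Reasoning)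
  open import Tactic.RingSolver using (solve-∀)
  open import Tactic.RingSolver.Core.AlmostCommutativeRing
    using (AlmostCommutativeRing; fromCommutativeRing)

  ℚ-ring : AlmostCommutativeRing 0ℓ 0ℓ
  ℚ-ring = fromCommutativeRing +-*-commutativeRing λ x → dec⇒maybe (0ℚ ≟ x)

  nCk*[k!*[n∸k]!]≡n! : ∀ {n k} → k ℕ.≤ n → (n C k) ℕ.* (k ! ℕ.* (n ℕ.∸ k) !) ≡ n !
  nCk*[k!*[n∸k]!]≡n! {n} {k} k≤n = begin
    (n C k) ℕ.* d    ≡⟨ cong (ℕ._* d) (nCk≡n!/k![n-k]! k≤n) ⟩
    n ! ℕ./ d ℕ.* d  ≡⟨ m/n*n≡m (k![n∸k]!∣n! k≤n) ⟩
    n !              ∎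
    where
    open ≡-Reasoning
    d : ℕ
    d = k ! ℕ.* (n ℕ.∸ k) !
    instance _ = k ℕ.!* (n ℕ.∸ k) !≢0

  [m+n]Cm*[m!*n!]≡[m+n]! : ∀ m n → ((m ℕ.+ n) C m) ℕ.* (m ! ℕ.* n !) ≡ (m ℕ.+ n) !
  [m+n]Cm*[m!*n!]≡[m+n]! m n = subst (λ k → ((m ℕ.+ n) C m) ℕ.* (m ! ℕ.* k !) ≡ (m ℕ.+ n) !)
    (ℕ.m+n∸m≡n m n) (nCk*[k!*[n∸k]!]≡n! (ℕ.m≤m+n m n))

  [1+n]*[m+[1+n]]Cm≡[1+m+n]*[m+n]Cm : ∀ m n →
    suc n ℕ.* ((m ℕ.+ suc n) C m) ≡ suc (m ℕ.+ n) ℕ.* ((m ℕ.+ n) C m)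
  [1+n]*[m+[1+n]]Cm≡[1+m+n]*[m+n]Cm m n = ℕ.*-cancelʳ-≡ _ _ (m ! ℕ.* n !) {{m ℕ.!* n !≢0}} (begin
    suc n ℕ.* B′ ℕ.* (m ! ℕ.* n !)          ≡⟨ regroup (suc n) B′ (m !) (n !) ⟩
    B′ ℕ.* (m ! ℕ.* suc n !)                ≡⟨ [m+n]Cm*[m!*n!]≡[m+n]! m (suc n) ⟩
    (m ℕ.+ suc n) !                         ≡⟨ cong _! (ℕ.+-suc m n) ⟩
    suc (m ℕ.+ n) ℕ.* (m ℕ.+ n) !           ≡⟨ cong (suc (m ℕ.+ n) ℕ.*_) ([m+n]Cm*[m!*n!]≡[m+n]! m n) ⟨
    suc (m ℕ.+ n) ℕ.* (B ℕ.* (m ! ℕ.* n !)) ≡⟨ ℕ.*-assoc (suc (m ℕ.+ n)) B (m ! ℕ.* n !) ⟨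
    suc (m ℕ.+ n) ℕ.* B ℕ.* (m ! ℕ.* n !)   ∎)
    where
    open ≡-Reasoning
    B B′ : ℕ
    B = (m ℕ.+ n) C m
    B′ = (m ℕ.+ suc n) C m
    regroup : ∀ a b x y → a ℕ.* b ℕ.* (x ℕ.* y) ≡ b ℕ.* (x ℕ.* (a ℕ.* y))
    regroup = ℕ-Solver.solve-∀

  -- ℕ→ℚ n = + n / 1 normalises by a gcd that does not compute for variable n, so
  -- arithmetic on ℕ→ℚ is transported from ℚᵘ, where the fraction stays n/1.
  toℚᵘ-ℕ→ℚ : ∀ n → toℚᵘ (ℕ→ℚ n) ℚᵘ.≃ ℚᵘ.mkℚᵘ (+ n) 0
  toℚᵘ-ℕ→ℚ n = toℚᵘ-fromℚᵘ (ℚᵘ.mkℚᵘ (+ n) 0)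

  ℕ→ℚ-+ : ∀ m n → ℕ→ℚ (m ℕ.+ n) ≡ ℕ→ℚ m + ℕ→ℚ n
  ℕ→ℚ-+ m n = toℚᵘ-injective (begin
    toℚᵘ (ℕ→ℚ (m ℕ.+ n))                  ≈⟨ toℚᵘ-ℕ→ℚ (m ℕ.+ n) ⟩
    ℚᵘ.mkℚᵘ (+ (m ℕ.+ n)) 0               ≈⟨ ℚᵘ.*≡* (trans (cong (ℤ._* + 1) (ℤ.pos-+ m n)) (distrib (+ m) (+ n))) ⟩
    ℚᵘ.mkℚᵘ (+ m) 0 ℚᵘ.+ ℚᵘ.mkℚᵘ (+ n) 0 ≈⟨ ℚᵘ.+-cong (toℚᵘ-ℕ→ℚ m) (toℚᵘ-ℕ→ℚ n) ⟨
    toℚᵘ (ℕ→ℚ m) ℚᵘ.+ toℚᵘ (ℕ→ℚ n)       ≈⟨ toℚᵘ-homo-+ (ℕ→ℚ m) (ℕ→ℚ n) ⟨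
    toℚᵘ (ℕ→ℚ m + ℕ→ℚ n)                  ∎)
    where
    open ℚᵘ.≃-Reasoning
    distrib : ∀ x y → (x ℤ.+ y) ℤ.* + 1 ≡ (x ℤ.* + 1 ℤ.+ y ℤ.* + 1) ℤ.* + 1
    distrib = ℤ-Solver.solve-∀

  ℕ→ℚ-* : ∀ m n → ℕ→ℚ (m ℕ.* n) ≡ ℕ→ℚ m * ℕ→ℚ n
  ℕ→ℚ-* m n = toℚᵘ-injective (begin
    toℚᵘ (ℕ→ℚ (m ℕ.* n))                  ≈⟨ toℚᵘ-ℕ→ℚ (m ℕ.* n) ⟩
    ℚᵘ.mkℚᵘ (+ (m ℕ.* n)) 0               ≈⟨ ℚᵘ.*≡* (cong (ℤ._* + 1) (ℤ.pos-* m n)) ⟩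
    ℚᵘ.mkℚᵘ (+ m) 0 ℚᵘ.* ℚᵘ.mkℚᵘ (+ n) 0 ≈⟨ ℚᵘ.*-cong (toℚᵘ-ℕ→ℚ m) (toℚᵘ-ℕ→ℚ n) ⟨
    toℚᵘ (ℕ→ℚ m) ℚᵘ.* toℚᵘ (ℕ→ℚ n)       ≈⟨ toℚᵘ-homo-* (ℕ→ℚ m) (ℕ→ℚ n) ⟨
    toℚᵘ (ℕ→ℚ m * ℕ→ℚ n)                  ∎)
    where open ℚᵘ.≃-Reasoning

  ℕ→ℚ-*-inverseʳ : ∀ n → ℕ→ℚ (suc n) * (+ 1 / suc n) ≡ 1ℚ
  ℕ→ℚ-*-inverseʳ n = toℚᵘ-injective (begin
    toℚᵘ (ℕ→ℚ (suc n) * (+ 1 / suc n))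
      ≈⟨ toℚᵘ-homo-* (ℕ→ℚ (suc n)) (+ 1 / suc n) ⟩
    toℚᵘ (ℕ→ℚ (suc n)) ℚᵘ.* toℚᵘ (+ 1 / suc n)
      ≈⟨ ℚᵘ.*-cong (toℚᵘ-ℕ→ℚ (suc n)) (toℚᵘ-fromℚᵘ (ℚᵘ.mkℚᵘ (+ 1) n)) ⟩
    ℚᵘ.mkℚᵘ (+ suc n) 0 ℚᵘ.* ℚᵘ.mkℚᵘ (+ 1) n
      ≈⟨ ℚᵘ.*-inverseʳ (ℚᵘ.mkℚᵘ (+ suc n) 0) ⟩
    ℚᵘ.1ℚᵘ ∎)
    where open ℚᵘ.≃-Reasoning

  ℕ→ℚ-nonNeg : ∀ n → NonNegative (ℕ→ℚ n)
  ℕ→ℚ-nonNeg n = normalize-nonNeg n 1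

  ℕ→ℚ-suc-pos : ∀ n → Positive (ℕ→ℚ (suc n))
  ℕ→ℚ-suc-pos n = normalize-pos (suc n) 1

  p≤p+q : ∀ p {q} → 0ℚ ≤ q → p ≤ p + q
  p≤p+q p {q} 0≤q = subst (_≤ p + q) (+-identityʳ p) (+-monoʳ-≤ p 0≤q)

  p≤q⇒0≤q-p : ∀ {p q} → p ≤ q → 0ℚ ≤ q - p
  p≤q⇒0≤q-p {p} {q} p≤q = subst (_≤ q - p) (+-inverseʳ p) (+-monoˡ-≤ (- p) p≤q)

  p-q<p : ∀ p q .{{_ : Positive q}} → p - q < p
  p-q<p p q = subst (p - q <_) (+-identityʳ p) (+-monoʳ-< p (neg-antimono-< (positive⁻¹ q)))

  *-nonNeg : ∀ {p q} → 0ℚ ≤ p → 0ℚ ≤ q → 0ℚ ≤ p * q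
  *-nonNeg {p} {q} 0≤p 0≤q =
    nonNegative⁻¹ (p * q) {{nonNeg*nonNeg⇒nonNeg p {{nonNegative 0≤p}} q {{nonNegative 0≤q}}}}

  1/suc-nonNeg : ∀ n → 0ℚ ≤ + 1 / suc n
  1/suc-nonNeg n = nonNegative⁻¹ (+ 1 / suc n) {{normalize-nonNeg 1 (suc n)}}

  expTerm-nonNeg : ∀ {y} → 0ℚ ≤ y → ∀ k → 0ℚ ≤ expTerm y k
  expTerm-nonNeg 0≤y zero    = nonNegative⁻¹ 1ℚ
  expTerm-nonNeg 0≤y (suc k) = *-nonNeg (*-nonNeg (expTerm-nonNeg 0≤y k) 0≤y) (1/suc-nonNeg k)

  expPartial-mono : ∀ {y M N} → 0ℚ ≤ y → M ℕ.≤ N → expPartial y M ≤ expPartial y N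
  expPartial-mono {y} 0≤y M≤N = go (ℕ.≤⇒≤′ M≤N)
    where
    go : ∀ {M N} → M ≤′ N → expPartial y M ≤ expPartial y N
    go ≤′-refl                    = ≤-refl
    go {N = suc N} (≤′-step M≤′N) = ≤-trans (go M≤′N) (p≤p+q _ (expTerm-nonNeg 0≤y (suc N)))

  ℕ→ℚ[1+k]*expTerm[1+k]≡expTerm*y : ∀ y k → ℕ→ℚ (suc k) * expTerm y (suc k) ≡ expTerm y k * y
  ℕ→ℚ[1+k]*expTerm[1+k]≡expTerm*y y k = begin
    K * (t * y * r) ≡⟨ regroup K t y r ⟩
    t * y * (K * r) ≡⟨ cong (t * y *_) (ℕ→ℚ-*-inverseʳ k) ⟩
    t * y * 1ℚ      ≡⟨ *-identityʳ (t * y) ⟩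
    t * y           ∎
    where
    open ≡-Reasoning
    K t r : ℚ
    K = ℕ→ℚ (suc k)
    t = expTerm y k
    r = + 1 / suc k
    regroup : ∀ K t y r → K * (t * y * r) ≡ t * y * (K * r)
    regroup = solve-∀ ℚ-ring

  -- (a + b)^(k+1) ≥ b^(k+1) + (k+1) a b^k, divided by (k+1)!.
  expTerm-+-≥ : ∀ {a b} → 0ℚ ≤ a → 0ℚ ≤ b → ∀ k →
    expTerm b (suc k) + a * expTerm b k ≤ expTerm (a + b) (suc k)
  expTerm-+-≥ {a} {b} 0≤a 0≤b zero = ≤-reflexive (base a b)
    where
    base : ∀ a b → 1ℚ * b * 1ℚ + a * 1ℚ ≡ 1ℚ * (a + b) * 1ℚ
    base = solve-∀ ℚ-ring
  expTerm-+-≥ {a} {b} 0≤a 0≤b (suc k) = begin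
    t₁ * b * r + a * t₁                   ≤⟨ p≤p+q _ 0≤a*a*t*r ⟩
    t₁ * b * r + a * t₁ + a * a * t * r   ≡⟨ expand ⟨
    (t₁ + a * t) * (a + b) * r            ≤⟨ *-monoʳ-≤-nonNeg r {{nonNegative (1/suc-nonNeg (suc k))}}
                                               (*-monoʳ-≤-nonNeg (a + b) {{nonNegative (+-mono-≤ 0≤a 0≤b)}}
                                                 (expTerm-+-≥ 0≤a 0≤b k)) ⟩
    expTerm (a + b) (suc k) * (a + b) * r ∎
    where
    open ≤-Reasoning
    t t₁ r K : ℚ
    t = expTerm b k
    t₁ = expTerm b (suc k)
    r = + 1 / suc (suc k)
    K = ℕ→ℚ (suc k)
    0≤a*a*t*r : 0ℚ ≤ a * a * t * r
    0≤a*a*t*r = *-nonNeg (*-nonNeg (*-nonNeg 0≤a 0≤a) (expTerm-nonNeg 0≤b k)) (1/suc-nonNeg (suc k))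
    expand : (t₁ + a * t) * (a + b) * r ≡ t₁ * b * r + a * t₁ + a * a * t * r
    expand = begin-equality
      (t₁ + a * t) * (a + b) * r
        ≡⟨ distrib t₁ t a b r ⟩
      t₁ * b * r + a * (t * b) * r + a * t₁ * r + a * a * t * r
        ≡⟨ cong (λ u → t₁ * b * r + a * u * r + a * t₁ * r + a * a * t * r) (ℕ→ℚ[1+k]*expTerm[1+k]≡expTerm*y b k) ⟨
      t₁ * b * r + a * (K * t₁) * r + a * t₁ * r + a * a * t * r
        ≡⟨ collect t₁ b r a K t ⟩
      t₁ * b * r + a * t₁ * ((1ℚ + K) * r) + a * a * t * r
        ≡⟨ cong (λ u → t₁ * b * r + a * t₁ * u + a * a * t * r) [1+K]*r≡1 ⟩
      t₁ * b * r + a * t₁ * 1ℚ + a * a * t * r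
        ≡⟨ cong (λ u → t₁ * b * r + u + a * a * t * r) (*-identityʳ (a * t₁)) ⟩
      t₁ * b * r + a * t₁ + a * a * t * r ∎
      where
      distrib : ∀ t₁ t a b r →
        (t₁ + a * t) * (a + b) * r ≡ t₁ * b * r + a * (t * b) * r + a * t₁ * r + a * a * t * r
      distrib = solve-∀ ℚ-ring
      collect : ∀ t₁ b r a K t →
        t₁ * b * r + a * (K * t₁) * r + a * t₁ * r + a * a * t * r ≡
        t₁ * b * r + a * t₁ * ((1ℚ + K) * r) + a * a * t * r
      collect = solve-∀ ℚ-ring
      [1+K]*r≡1 : (1ℚ + K) * r ≡ 1ℚ
      [1+K]*r≡1 = trans (cong (_* r) (sym (ℕ→ℚ-+ 1 (suc k)))) (ℕ→ℚ-*-inverseʳ (suc k))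

  expPartial-+-≥ : ∀ {a b} → 0ℚ ≤ a → 0ℚ ≤ b → ∀ N →
    expPartial b (suc N) + a * expPartial b N ≤ expPartial (a + b) (suc N)
  expPartial-+-≥ {a} {b} 0≤a 0≤b zero = ≤-reflexive (base a b)
    where
    base : ∀ a b → 1ℚ + 1ℚ * b * 1ℚ + a * 1ℚ ≡ 1ℚ + 1ℚ * (a + b) * 1ℚ
    base = solve-∀ ℚ-ring
  expPartial-+-≥ {a} {b} 0≤a 0≤b (suc N) = begin
    S + t₁ + t₂ + a * (S + t₁)       ≡⟨ regroup S t₁ t₂ a ⟩
    (S + t₁ + a * S) + (t₂ + a * t₁) ≤⟨ +-mono-≤ (expPartial-+-≥ 0≤a 0≤b N) (expTerm-+-≥ 0≤a 0≤b (suc N)) ⟩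
    expPartial (a + b) (suc (suc N)) ∎
    where
    open ≤-Reasoning
    S t₁ t₂ : ℚ
    S = expPartial b N
    t₁ = expTerm b (suc N)
    t₂ = expTerm b (suc (suc N))
    regroup : ∀ S t₁ t₂ a → S + t₁ + t₂ + a * (S + t₁) ≡ (S + t₁ + a * S) + (t₂ + a * t₁)
    regroup = solve-∀ ℚ-ring

  [1+a]*expPartial≤expPartial-+ : ∀ {a b} → 0ℚ ≤ a → 0ℚ ≤ b → ∀ N →
    (1ℚ + a) * expPartial b N ≤ expPartial (a + b) (suc N)
  [1+a]*expPartial≤expPartial-+ {a} {b} 0≤a 0≤b N = begin
    (1ℚ + a) * S                   ≡⟨ *-distribʳ-+ S 1ℚ a ⟩
    1ℚ * S + a * S                 ≡⟨ cong (_+ a * S) (*-identityˡ S) ⟩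
    S + a * S                      ≤⟨ +-monoˡ-≤ (a * S) (expPartial-mono 0≤b (ℕ.n≤1+n N)) ⟩
    expPartial b (suc N) + a * S   ≤⟨ expPartial-+-≥ 0≤a 0≤b N ⟩
    expPartial (a + b) (suc N)     ∎
    where
    open ≤-Reasoning
    S : ℚ
    S = expPartial b N

  ≤expPartial⇒≤exp : ∀ {x y} → 0ℚ ≤ y → Σ ℕ (λ N → x ≤ expPartial y N) → x ≤exp y
  ≤expPartial⇒≤exp {x} 0≤y (N , x≤S) ε ε>0 =
    N , λ n N≤n → <-≤-trans (p-q<p x ε {{ε>0}}) (≤-trans x≤S (expPartial-mono 0≤y N≤n))

  H-mono : ∀ j k → H j ≤ H (k ℕ.+ j)
  H-mono j zero    = ≤-refl
  H-mono j (suc k) = ≤-trans (H-mono j k) (p≤p+q (H (k ℕ.+ j)) (1/suc-nonNeg (k ℕ.+ j)))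

  ℕ→ℚ[2+n]≡[1+1/[1+n]]*ℕ→ℚ[1+n] : ∀ n → ℕ→ℚ (suc (suc n)) ≡ (1ℚ + + 1 / suc n) * ℕ→ℚ (suc n)
  ℕ→ℚ[2+n]≡[1+1/[1+n]]*ℕ→ℚ[1+n] n = begin
    ℕ→ℚ (suc (suc n))  ≡⟨ ℕ→ℚ-+ 1 (suc n) ⟩
    1ℚ + K             ≡⟨ cong (_+ K) (ℕ→ℚ-*-inverseʳ n) ⟨
    K * r + K          ≡⟨ factor K r ⟩
    (1ℚ + r) * K       ∎
    where
    open ≡-Reasoning
    K r : ℚ
    K = ℕ→ℚ (suc n)
    r = + 1 / suc n
    factor : ∀ K r → K * r + K ≡ (1ℚ + r) * K
    factor = solve-∀ ℚ-ring

  -- (k+j+1)/(j+1) = ∏_{i=j+1}^{k+j} (1 + 1/i) ≤ exp (H_{k+j} - H_j), cleared of the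
  -- denominator and applied on top of a bound x ≤ exp y.
  [1+k+j]/[1+j]≤exp[H[k+j]-Hj] : ∀ {x y N} j → 0ℚ ≤ y → x ≤ expPartial y N → ∀ k →
    ℕ→ℚ (suc (k ℕ.+ j)) * x ≤ ℕ→ℚ (suc j) * expPartial (y + (H (k ℕ.+ j) - H j)) (k ℕ.+ N)
  [1+k+j]/[1+j]≤exp[H[k+j]-Hj] {x} {y} {N} j 0≤y x≤S zero = begin
    J * x                                  ≤⟨ *-monoˡ-≤-nonNeg J x≤S ⟩
    J * expPartial y N                     ≡⟨ cong (λ z → J * expPartial z N) (cancel y (H j)) ⟨
    J * expPartial (y + (H j - H j)) N     ∎
    where
    open ≤-Reasoning
    J : ℚ
    J = ℕ→ℚ (suc j)
    instance _ = ℕ→ℚ-nonNeg (suc j)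
    cancel : ∀ y h → y + (h - h) ≡ y
    cancel = solve-∀ ℚ-ring
  [1+k+j]/[1+j]≤exp[H[k+j]-Hj] {x} {y} {N} j 0≤y x≤S (suc k) = begin
    ℕ→ℚ (suc (suc (k ℕ.+ j))) * x          ≡⟨ cong (_* x) (ℕ→ℚ[2+n]≡[1+1/[1+n]]*ℕ→ℚ[1+n] (k ℕ.+ j)) ⟩
    (1ℚ + r) * M * x                       ≡⟨ *-assoc (1ℚ + r) M x ⟩
    (1ℚ + r) * (M * x)                     ≤⟨ *-monoˡ-≤-nonNeg (1ℚ + r) ([1+k+j]/[1+j]≤exp[H[k+j]-Hj] j 0≤y x≤S k) ⟩
    (1ℚ + r) * (J * S)                     ≡⟨ swap (1ℚ + r) J S ⟩
    J * ((1ℚ + r) * S)                     ≤⟨ *-monoˡ-≤-nonNeg J ([1+a]*expPartial≤expPartial-+ 0≤r 0≤w (k ℕ.+ N)) ⟩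
    J * expPartial (r + w) (suc (k ℕ.+ N)) ≡⟨ cong (λ z → J * expPartial z (suc (k ℕ.+ N))) (shift r y (H (k ℕ.+ j)) (H j)) ⟩
    J * expPartial (y + (H (suc (k ℕ.+ j)) - H j)) (suc (k ℕ.+ N)) ∎
    where
    open ≤-Reasoning
    M J r w S : ℚ
    M = ℕ→ℚ (suc (k ℕ.+ j))
    J = ℕ→ℚ (suc j)
    r = + 1 / suc (k ℕ.+ j)
    w = y + (H (k ℕ.+ j) - H j)
    S = expPartial w (k ℕ.+ N)
    0≤r : 0ℚ ≤ r
    0≤r = 1/suc-nonNeg (k ℕ.+ j)
    0≤w : 0ℚ ≤ w
    0≤w = +-mono-≤ 0≤y (p≤q⇒0≤q-p (H-mono j k))
    instance
      _ = ℕ→ℚ-nonNeg (suc j)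
      _ = nonNegative (+-mono-≤ (nonNegative⁻¹ 1ℚ) 0≤r)
    swap : ∀ a b c → a * (b * c) ≡ b * (a * c)
    swap = solve-∀ ℚ-ring
    shift : ∀ r y h h′ → r + (y + (h - h′)) ≡ y + (h + r - h′)
    shift = solve-∀ ℚ-ring

  ℕ→ℚ[1+n]*H[1+n]≡ℕ→ℚn*Hn+Hn+1 : ∀ n → ℕ→ℚ (suc n) * H (suc n) ≡ ℕ→ℚ n * H n + H n + 1ℚ
  ℕ→ℚ[1+n]*H[1+n]≡ℕ→ℚn*Hn+Hn+1 n = begin
    ℕ→ℚ (suc n) * (H n + r)              ≡⟨ *-distribˡ-+ (ℕ→ℚ (suc n)) (H n) r ⟩
    ℕ→ℚ (suc n) * H n + ℕ→ℚ (suc n) * r ≡⟨ cong (_+_ (ℕ→ℚ (suc n) * H n)) (ℕ→ℚ-*-inverseʳ n) ⟩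
    ℕ→ℚ (suc n) * H n + 1ℚ              ≡⟨ cong (λ u → u * H n + 1ℚ) (ℕ→ℚ-+ 1 n) ⟩
    (1ℚ + ℕ→ℚ n) * H n + 1ℚ             ≡⟨ expand (ℕ→ℚ n) (H n) ⟩
    ℕ→ℚ n * H n + H n + 1ℚ              ∎
    where
    open ≡-Reasoning
    r : ℚ
    r = + 1 / suc n
    expand : ∀ N h → (1ℚ + N) * h + 1ℚ ≡ N * h + h + 1ℚ
    expand = solve-∀ ℚ-ring

  gap-suc : ∀ m n → gap m (suc n) ≡ gap m n + (H (m ℕ.+ n) - H n)
  gap-suc m n = begin
    gap m (suc n)
      ≡⟨ cong (λ i → ℕ→ℚ i * H i - A * H m - ℕ→ℚ (suc n) * H (suc n)) (ℕ.+-suc m n) ⟩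
    ℕ→ℚ (suc (m ℕ.+ n)) * H (suc (m ℕ.+ n)) - A * H m - ℕ→ℚ (suc n) * H (suc n)
      ≡⟨ cong₂ (λ u v → u - A * H m - v)
           (ℕ→ℚ[1+n]*H[1+n]≡ℕ→ℚn*Hn+Hn+1 (m ℕ.+ n)) (ℕ→ℚ[1+n]*H[1+n]≡ℕ→ℚn*Hn+Hn+1 n) ⟩
    (ℕ→ℚ (m ℕ.+ n) * H (m ℕ.+ n) + H (m ℕ.+ n) + 1ℚ) - A * H m - (ℕ→ℚ n * H n + H n + 1ℚ)
      ≡⟨ regroup (ℕ→ℚ (m ℕ.+ n)) (H (m ℕ.+ n)) A (H m) (ℕ→ℚ n) (H n) ⟩
    gap m n + (H (m ℕ.+ n) - H n) ∎
    where
    open ≡-Reasoning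
    A : ℚ
    A = ℕ→ℚ m
    regroup : ∀ N h A a B b →
      (N * h + h + 1ℚ) - A * a - (B * b + b + 1ℚ) ≡ N * h - A * a - B * b + (h - b)
    regroup = solve-∀ ℚ-ring

  gap-nonNeg : ∀ m n → 0ℚ ≤ gap m n
  gap-nonNeg m zero    = ≤-reflexive (sym gap-zero)
    where
    cancel : ∀ x h → x * h - x * h - 0ℚ * 0ℚ ≡ 0ℚ
    cancel = solve-∀ ℚ-ring
    gap-zero : gap m zero ≡ 0ℚ
    gap-zero = trans (cong (λ i → ℕ→ℚ i * H i - ℕ→ℚ m * H m - 0ℚ * 0ℚ) (ℕ.+-identityʳ m))
                     (cancel (ℕ→ℚ m) (H m))
  gap-nonNeg m (suc n) = subst (0ℚ ≤_) (sym (gap-suc m n))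
    (+-mono-≤ (gap-nonNeg m n) (p≤q⇒0≤q-p (H-mono n m)))

  [m+n]Cm≤expPartial-gap : ∀ m n → Σ ℕ λ N → ℕ→ℚ ((m ℕ.+ n) C m) ≤ expPartial (gap m n) N
  [m+n]Cm≤expPartial-gap m zero =
    0 , ≤-reflexive (cong ℕ→ℚ (trans (cong (_C m) (ℕ.+-identityʳ m)) (nCn≡1 m)))
  [m+n]Cm≤expPartial-gap m (suc n) with [m+n]Cm≤expPartial-gap m n
  ... | N , C≤S = m ℕ.+ N , *-cancelˡ-≤-pos (ℕ→ℚ (suc n)) (begin
    ℕ→ℚ (suc n) * ℕ→ℚ ((m ℕ.+ suc n) C m)          ≡⟨ ratio ⟩
    ℕ→ℚ (suc (m ℕ.+ n)) * ℕ→ℚ ((m ℕ.+ n) C m)      ≤⟨ [1+k+j]/[1+j]≤exp[H[k+j]-Hj] n (gap-nonNeg m n) C≤S m ⟩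
    ℕ→ℚ (suc n) * expPartial (gap m n + (H (m ℕ.+ n) - H n)) (m ℕ.+ N)
      ≡⟨ cong (λ g → ℕ→ℚ (suc n) * expPartial g (m ℕ.+ N)) (gap-suc m n) ⟨
    ℕ→ℚ (suc n) * expPartial (gap m (suc n)) (m ℕ.+ N) ∎)
    where
    open ≤-Reasoning
    instance _ = ℕ→ℚ-suc-pos n
    ratio : ℕ→ℚ (suc n) * ℕ→ℚ ((m ℕ.+ suc n) C m) ≡ ℕ→ℚ (suc (m ℕ.+ n)) * ℕ→ℚ ((m ℕ.+ n) C m)
    ratio = begin-equality
      ℕ→ℚ (suc n) * ℕ→ℚ ((m ℕ.+ suc n) C m)      ≡⟨ ℕ→ℚ-* (suc n) ((m ℕ.+ suc n) C m) ⟨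
      ℕ→ℚ (suc n ℕ.* ((m ℕ.+ suc n) C m))        ≡⟨ cong ℕ→ℚ ([1+n]*[m+[1+n]]Cm≡[1+m+n]*[m+n]Cm m n) ⟩
      ℕ→ℚ (suc (m ℕ.+ n) ℕ.* ((m ℕ.+ n) C m))    ≡⟨ ℕ→ℚ-* (suc (m ℕ.+ n)) ((m ℕ.+ n) C m) ⟩
      ℕ→ℚ (suc (m ℕ.+ n)) * ℕ→ℚ ((m ℕ.+ n) C m)  ∎

  [m+n]Cm-·ln-≤-gap : ∀ m n → 1ℚ ·ln ((m ℕ.+ n) C m) ≤ gap m n
  [m+n]Cm-·ln-≤-gap m n =
    subst₂ _≤exp_ (cong ℕ→ℚ (sym (ℕ.*-identityʳ ((m ℕ.+ n) C m)))) (sym (*-identityˡ (gap m n)))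
      (≤expPartial⇒≤exp (gap-nonNeg m n) ([m+n]Cm≤expPartial-gap m n))

open import Data.Nat using (ℕ; _≥_; _+_)
open import Data.Nat.Combinatorics using (_C_)
open import Data.Rational using (ℚ; Positive; 1ℚ)
open import Data.Product using (Σ; _,_)

lemma13 : Σ ℚ λ c → Σ (Positive c) λ _ →
    (n₁ n₂ : ℕ) → n₁ ≥ 1 → n₂ ≥ 1 →
      c ·ln ((n₁ + n₂) C n₁) ≤ gap n₁ n₂
lemma13 = 1ℚ , _ , λ n₁ n₂ _ _ → [m+n]Cm-·ln-≤-gap n₁ n₂
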